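{- Let $G$ and $H$ be connected graphs, at least one of which is not complete, with $|V(G)|=s$, $|V(H)|=t$ and $s\leq t$. Let $c_1=\max\{rx_3(G),rx_3(H)\}$. Then: (1) if $s=1$, then $rx_3(G\vee H)\leq rx_3(H)+1$; (2) if $2=s\leq t$, then $rx_3(G\vee H)\leq \min\{rc(H)+3,\ rx_3(K_{2,t})\}$; (3) if $3\leq s\leq t$, then $rx_3(G\vee H)\leq \min\{c_1+1,\ rx_3(K_{s,t})\}$. In particular, if $s=t\geq 3$, then $rx_3(G\vee H)=rx_3(K_{s,t})=3$.
   Context: All graphs are simple and undirected. $G\vee H$ (the join) is obtained from the disjoint union of $G$ and $H$ by adding all edges joining each vertex of $G$ to each vertex of $H$. In an edge-colored graph (adjacent edges may share colors), a path or tree is rainbow if no two of its edges have the same color. $rc(H)$ is the minimum number of colors in an edge coloring of $H$ such that every pair of distinct vertices is joined by a rainbow path. An edge coloring is a $3$-rainbow coloring if every set of $3$ vertices is contained in some rainbow tree; $rx_3(G)$ is the minimum number of colors in a $3$-rainbow coloring. $K_{s,t}$ is the complete bipartite graph with parts of sizes $s$ and $t$. -}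

module Defs where

open import Data.Nat using (ℕ; _≤_; _+_)
open import Data.Fin using (Fin; splitAt)
open import Data.Bool using (Bool; true; false)
open import Data.Sum using (_⊎_; inj₁; inj₂)
open import Data.Product using (Σ; _×_; _,_; ∃)
open import Data.List using (List; []; _∷_; map)
open import Data.List.Membership.Propositional using (_∈_; _∉_)
open import Data.List.Relation.Unary.Unique.Propositional using (Unique)
open import Relation.Binary.PropositionalEquality using (_≡_; _≢_)

record Graph (n : ℕ) : Set where
  field
    adj   : Fin n → Fin n → Bool
    sym   : ∀ u v → adj u v ≡ adj v u
    irrefl : ∀ v → adj v v ≡ false
open Graph public

Edge : ℕ → Set
Edge n = Fin n × Fin n

data Path {n : ℕ} (G : Graph n) : Fin n → Fin n → List (Fin n) → List (Edge n) → Set where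
  here : ∀ v → Path G v v (v ∷ []) []
  step : ∀ {u w v W E} → adj G u w ≡ true → u ∉ W → Path G w v W E →
         Path G u v (u ∷ W) ((u , w) ∷ E)

Connected : ∀ {n} → Graph n → Set
Connected {n} G = ∀ (u v : Fin n) → Σ (List (Fin n)) λ W → Σ (List (Edge n)) λ E → Path G u v W E

Complete : ∀ {n} → Graph n → Set
Complete {n} G = ∀ (u v : Fin n) → u ≢ v → adj G u v ≡ true

-- Trees in G, built by successively attaching pendant edges;
-- indexed by vertex list and edge list.
data Tree {n : ℕ} (G : Graph n) : List (Fin n) → List (Edge n) → Set where
  single : ∀ v → Tree G (v ∷ []) []
  grow   : ∀ {W E u v} → Tree G W E → u ∈ W → v ∉ W → adj G u v ≡ true →
           Tree G (v ∷ W) ((u , v) ∷ E)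

-- Edge colorings with colors from Fin k (symmetric, so edges are unordered).
record Coloring {n : ℕ} (G : Graph n) (k : ℕ) : Set where
  field
    col     : Fin n → Fin n → Fin k
    col-sym : ∀ u v → col u v ≡ col v u
open Coloring public

colors : ∀ {n k} {G : Graph n} → Coloring G k → List (Edge n) → List (Fin k)
colors c E = map (λ e → col c (Data.Product.proj₁ e) (Data.Product.proj₂ e)) E

IsRainbowConnected : ∀ {n k} {G : Graph n} → Coloring G k → Set
IsRainbowConnected {n} {G = G} c = ∀ (u v : Fin n) → u ≢ v →
  Σ (List (Fin n)) λ W → Σ (List (Edge n)) λ E → Path G u v W E × Unique (colors c E)

Is3Rainbow : ∀ {n k} {G : Graph n} → Coloring G k → Set
Is3Rainbow {n} {G = G} c = ∀ (x y z : Fin n) → x ≢ y → y ≢ z → x ≢ z →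
  Σ (List (Fin n)) λ W → Σ (List (Edge n)) λ E →
    Tree G W E × Unique (colors c E) × x ∈ W × y ∈ W × z ∈ W

IsMin : (ℕ → Set) → ℕ → Set
IsMin P k = P k × (∀ j → P j → k ≤ j)

IsRc : ∀ {n} → Graph n → ℕ → Set
IsRc G = IsMin (λ k → Σ (Coloring G k) IsRainbowConnected)

IsRx3 : ∀ {n} → Graph n → ℕ → Set
IsRx3 G = IsMin (λ k → Σ (Coloring G k) Is3Rainbow)

-- Join G ∨ H on Fin (s + t): first s vertices are G, last t are H.
joinAdj : ∀ {s t} → Graph s → Graph t → Fin (s + t) → Fin (s + t) → Bool
joinAdj {s} G H i j with splitAt s i | splitAt s j
... | inj₁ a | inj₁ b = adj G a b
... | inj₂ a | inj₂ b = adj H a b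
... | inj₁ _ | inj₂ _ = true
... | inj₂ _ | inj₁ _ = true

joinSym : ∀ {s t} (G : Graph s) (H : Graph t) i j → joinAdj G H i j ≡ joinAdj G H j i
joinSym {s} G H i j with splitAt s i | splitAt s j
... | inj₁ a | inj₁ b = sym G a b
... | inj₂ a | inj₂ b = sym H a b
... | inj₁ _ | inj₂ _ = Relation.Binary.PropositionalEquality.refl
... | inj₂ _ | inj₁ _ = Relation.Binary.PropositionalEquality.refl

joinIrr : ∀ {s t} (G : Graph s) (H : Graph t) i → joinAdj G H i i ≡ false
joinIrr {s} G H i with splitAt s i
... | inj₁ a = irrefl G a
... | inj₂ a = irrefl H a

_∨G_ : ∀ {s t} → Graph s → Graph t → Graph (s + t)
G ∨G H = record { adj = joinAdj G H ; sym = joinSym G H ; irrefl = joinIrr G H }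

Empty : (n : ℕ) → Graph n
Empty n = record { adj = λ _ _ → false ; sym = λ _ _ → Relation.Binary.PropositionalEquality.refl
                 ; irrefl = λ _ → Relation.Binary.PropositionalEquality.refl }

K : (s t : ℕ) → Graph (s + t)
K s t = Empty s ∨G Empty t

module Submission where

open import Defs
open import Data.Nat using (ℕ; _≤_; _+_; _⊓_; _⊔_; zero; suc; s≤s)
open import Data.Nat.Properties using (m≤m⊔n; m≤n⊔m; ⊓-glb; ≤-trans; ≤-antisym; +-mono-≤; ≰⇒>; ≤-pred)
  renaming (_≤?_ to _≤?ℕ_)
open import Data.Fin using (Fin; #_; splitAt; _↑ˡ_; _↑ʳ_; inject≤; _<_) renaming (zero to fz; suc to fs)
open import Data.Fin.Properties using (splitAt-↑ˡ; splitAt-↑ʳ; splitAt⁻¹-↑ˡ; splitAt⁻¹-↑ʳ; ↑ˡ-injective; ↑ʳ-injective;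
  all?; ¬∀⟶∃¬; inject≤-injective; <-cmp; <-asym; <-trans; <-irrefl; <⇒≢) renaming (_≟_ to _≟F_)
open import Data.Sum using (_⊎_; inj₁; inj₂; [_,_]′)
open import Data.Product using (Σ; _×_; _,_; proj₁; proj₂)
open import Data.List using (List; []; _∷_; map)
open import Data.List.Membership.Propositional using (_∈_; _∉_)
open import Data.List.Membership.Propositional.Properties using (∈-map⁺; ∈-map⁻)
import Data.List.Membership.DecPropositional as DecMembership
open import Data.List.Relation.Unary.Any using (here; there)
open import Data.List.Relation.Unary.All as All using (All)
open import Data.List.Relation.Unary.AllPairs using ([]; _∷_)
open import Data.List.Relation.Unary.Unique.Propositional using (Unique)
import Data.List.Relation.Unary.Unique.Propositional.Properties as UniqueProperties
open import Data.Bool using (true)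
open import Data.Bool.Properties using () renaming (_≟_ to _≟B_)
open import Data.Empty using (⊥; ⊥-elim)
open import Relation.Binary.Definitions using (tri<; tri≈; tri>)
open import Relation.Nullary using (¬_; yes; no)
open import Relation.Nullary.Decidable using (_→-dec_; ¬?)
open import Relation.Binary.PropositionalEquality
  using (_≡_; _≢_; refl; trans; cong; cong₂; subst; ≢-sym) renaming (sym to ≡-sym)

-- Every upper bound rx₃(G ∨ H) ≤ N is obtained by exhibiting a 3-rainbow
-- colouring of G ∨ H with N colours, since rx₃ is a minimum.
--  * rx₃(K_{s,t}) bounds rx₃(G ∨ H) because K_{s,t} is a spanning subgraph of
--    G ∨ H and a 3-rainbow colouring stays 3-rainbow on a supergraph.
--  * (1) and (3): colour G and H by 3-rainbow colourings with a common palette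
--    and all cross edges by one new colour; trees for triples meeting both sides
--    are a rainbow tree on one side plus one pendant cross edge.
--  * (2): for G = K₂ colour the edge of G by α, the cross edges at the two
--    vertices of G by ν₀ and ν₁, and H by a rainbow-connected colouring.
--  * s = t ≥ 3: K_{s,s} has a 3-rainbow colouring with 3 colours (colour the
--    edge ij by the outcome of comparing i with j), while no graph on ≥ 6
--    vertices has a 3-rainbow colouring with ≤ 2 colours: by the Ramsey argument
--    some triple is monochromatic, and a rainbow tree on ≤ 2 colours through
--    three vertices would be a path with two edges inside that triple.

RainbowTreeOn : ∀ {n k} (G : Graph n) (c : Coloring G k) (x y z : Fin n) → Set
RainbowTreeOn {n} G c x y z = Σ (List (Fin n)) λ W → Σ (List (Edge n)) λ E →
    Tree G W E × Unique (colors c E) × x ∈ W × y ∈ W × z ∈ W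

Distinct3 : ∀ {A : Set} → A → A → A → Set
Distinct3 a b c = (a ≢ b) × (b ≢ c) × (a ≢ c)

module _ {n k} {G : Graph n} (c : Coloring G k) {x y z : Fin n} where
  swap₁₂ : RainbowTreeOn G c x y z → RainbowTreeOn G c y x z
  swap₁₂ (W , E , T , U , x∈ , y∈ , z∈) = W , E , T , U , y∈ , x∈ , z∈
  swap₂₃ : RainbowTreeOn G c x y z → RainbowTreeOn G c x z y
  swap₂₃ (W , E , T , U , x∈ , y∈ , z∈) = W , E , T , U , x∈ , z∈ , y∈
  rotateʳ : RainbowTreeOn G c x y z → RainbowTreeOn G c z x y
  rotateʳ (W , E , T , U , x∈ , y∈ , z∈) = W , E , T , U , z∈ , x∈ , y∈

RainbowTree : ∀ {n k} (G : Graph n) (c : Coloring G k) → List (Fin n) → List (Edge n) → Set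
RainbowTree G c W E = Tree G W E × Unique (colors c E)

extend-rainbow : ∀ {n k} {G : Graph n} (c : Coloring G k) {W E u v} → Tree G W E → Unique (colors c E) →
  u ∈ W → v ∉ W → adj G u v ≡ true → All (col c u v ≢_) (colors c E) →
  RainbowTree G c (v ∷ W) ((u , v) ∷ E)
extend-rainbow c T U u∈ v∉ uv fresh = grow T u∈ v∉ uv , fresh ∷ U

module SmallTrees {n k} {G : Graph n} (c : Coloring G k) where
  star : ∀ q a b d → a ≢ q → b ≢ q → d ≢ q → Distinct3 a b d →
    adj G q a ≡ true → adj G q b ≡ true → adj G q d ≡ true →
    Distinct3 (col c q a) (col c q b) (col c q d) → RainbowTreeOn G c a b d
  star q a b d aq bq dq (ab , bd , ad) qa qb qd (κab , κbd , κad) =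
    _ , _ , proj₁ qabd , proj₂ qabd , there (there (here refl)) , there (here refl) , here refl
    where
    qa′ : RainbowTree G c (a ∷ q ∷ []) ((q , a) ∷ [])
    qa′ = extend-rainbow c (single q) [] (here refl) (λ { (here e) → aq e }) qa All.[]
    qab : RainbowTree G c (b ∷ a ∷ q ∷ []) ((q , b) ∷ (q , a) ∷ [])
    qab = extend-rainbow c (proj₁ qa′) (proj₂ qa′) (there (here refl))
            (λ { (here e) → ab (≡-sym e) ; (there (here e)) → bq e }) qb (≢-sym κab All.∷ All.[])
    qabd : RainbowTree G c (d ∷ b ∷ a ∷ q ∷ []) ((q , d) ∷ (q , b) ∷ (q , a) ∷ [])
    qabd = extend-rainbow c (proj₁ qab) (proj₂ qab) (there (there (here refl)))
             (λ { (here e) → bd (≡-sym e) ; (there (here e)) → ad (≡-sym e) ; (there (there (here e))) → dq e })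
             qd (≢-sym κbd All.∷ ≢-sym κad All.∷ All.[])

  path₂ : ∀ a q b → a ≢ q → q ≢ b → a ≢ b → adj G a q ≡ true → adj G q b ≡ true →
    col c a q ≢ col c q b → RainbowTreeOn G c a q b
  path₂ a q b aq qb ab a–q q–b κ≢ =
    _ , _ , proj₁ aqb , proj₂ aqb , there (there (here refl)) , there (here refl) , here refl
    where
    aq′ : RainbowTree G c (q ∷ a ∷ []) ((a , q) ∷ [])
    aq′ = extend-rainbow c (single a) [] (here refl) (λ { (here e) → aq (≡-sym e) }) a–q All.[]
    aqb : RainbowTree G c (b ∷ q ∷ a ∷ []) ((q , b) ∷ (a , q) ∷ [])
    aqb = extend-rainbow c (proj₁ aq′) (proj₂ aq′) (here refl)
            (λ { (here e) → qb (≡-sym e) ; (there (here e)) → ab (≡-sym e) }) q–b (≢-sym κ≢ All.∷ All.[])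

  path₃ : ∀ a b d e → a ≢ b → a ≢ d → a ≢ e → b ≢ d → b ≢ e → d ≢ e →
    adj G a b ≡ true → adj G b d ≡ true → adj G d e ≡ true →
    Distinct3 (col c a b) (col c b d) (col c d e) → RainbowTreeOn G c b e a
  path₃ a b d e ab ad ae bd be de a–b b–d d–e (κ₁₂ , κ₂₃ , κ₁₃) =
    _ , _ , proj₁ abde , proj₂ abde , there (there (here refl)) , here refl , there (there (there (here refl)))
    where
    ab′ : RainbowTree G c (b ∷ a ∷ []) ((a , b) ∷ [])
    ab′ = extend-rainbow c (single a) [] (here refl) (λ { (here eq) → ab (≡-sym eq) }) a–b All.[]
    abd : RainbowTree G c (d ∷ b ∷ a ∷ []) ((b , d) ∷ (a , b) ∷ [])
    abd = extend-rainbow c (proj₁ ab′) (proj₂ ab′) (here refl)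
            (λ { (here eq) → bd (≡-sym eq) ; (there (here eq)) → ad (≡-sym eq) }) b–d (≢-sym κ₁₂ All.∷ All.[])
    abde : RainbowTree G c (e ∷ d ∷ b ∷ a ∷ []) ((d , e) ∷ (b , d) ∷ (a , b) ∷ [])
    abde = extend-rainbow c (proj₁ abd) (proj₂ abd) (here refl)
             (λ { (here eq) → de (≡-sym eq) ; (there (here eq)) → be (≡-sym eq) ; (there (there (here eq))) → ae (≡-sym eq) })
             d–e (≢-sym κ₂₃ All.∷ ≢-sym κ₁₃ All.∷ All.[])

module Embedding {n m k k' : ℕ} {A : Graph n} {B : Graph m}
  (f : Fin n → Fin m) (f-inj : ∀ {a b} → f a ≡ f b → a ≡ b)
  (f-adj : ∀ {a b} → adj A a b ≡ true → adj B (f a) (f b) ≡ true)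
  (cA : Coloring A k) (cB : Coloring B k') (ι : Fin k → Fin k')
  (ι-inj : ∀ {a b} → ι a ≡ ι b → a ≡ b)
  (f-col : ∀ u v → col cB (f u) (f v) ≡ ι (col cA u v)) where

  mapE : List (Edge n) → List (Edge m)
  mapE = map (λ e → f (proj₁ e) , f (proj₂ e))

  ∉-map : ∀ {v W} → v ∉ W → f v ∉ map f W
  ∉-map v∉ fv∈ with ∈-map⁻ f fv∈
  ... | w , w∈ , eq rewrite f-inj eq = v∉ w∈

  tree-map : ∀ {W E} → Tree A W E → Tree B (map f W) (mapE E)
  tree-map (single v) = single (f v)
  tree-map (grow T u∈ v∉ a) = grow (tree-map T) (∈-map⁺ f u∈) (∉-map v∉) (f-adj a)

  colors-map : ∀ E → colors cB (mapE E) ≡ map ι (colors cA E)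
  colors-map [] = refl
  colors-map ((u , v) ∷ E) = cong₂ _∷_ (f-col u v) (colors-map E)

  unique-map : ∀ E → Unique (colors cA E) → Unique (colors cB (mapE E))
  unique-map E u rewrite colors-map E = UniqueProperties.map⁺ ι-inj u

  rainbowTree-map : ∀ {x y z} → RainbowTreeOn A cA x y z → RainbowTreeOn B cB (f x) (f y) (f z)
  rainbowTree-map (W , E , T , U , x∈ , y∈ , z∈) =
    map f W , mapE E , tree-map T , unique-map E U , ∈-map⁺ f x∈ , ∈-map⁺ f y∈ , ∈-map⁺ f z∈

  fresh-colour : ∀ (ν : Fin k') → (∀ a → ν ≢ ι a) → ∀ E → All (ν ≢_) (colors cB (mapE E))
  fresh-colour ν ν-fresh [] = All.[]
  fresh-colour ν ν-fresh ((p , q) ∷ E) =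
    (λ e → ν-fresh (col cA p q) (trans e (f-col p q))) All.∷ fresh-colour ν ν-fresh E

  add-leaf : ∀ {W E u w} → Tree A W E → Unique (colors cA E) → u ∈ W →
    (∀ a → w ≢ f a) → adj B (f u) w ≡ true → (∀ a → col cB (f u) w ≢ ι a) →
    RainbowTree B cB (w ∷ map f W) ((f u , w) ∷ mapE E)
  add-leaf {W} {E} {u} {w} T U u∈ w-new a ν-fresh =
    extend-rainbow cB (tree-map T) (unique-map E U) (∈-map⁺ f u∈) w∉ a (fresh-colour _ ν-fresh E)
    where
    w∉ : w ∉ map f W
    w∉ w∈ with ∈-map⁻ f w∈
    ... | a' , _ , eq = w-new a' eq

recolour : ∀ {n k k'} {G : Graph n} (ι : Fin k → Fin k') → (∀ {a b} → ι a ≡ ι b → a ≡ b) →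
  (c : Coloring G k) → Is3Rainbow c → Σ (Coloring G k') Is3Rainbow
recolour {k' = k'} {G = G} ι ι-inj c rainbow = c' , λ x y z xy yz xz → T.rainbowTree-map (rainbow x y z xy yz xz)
  where
  c' : Coloring G k'
  c' = record { col = λ u v → ι (col c u v) ; col-sym = λ u v → cong ι (col-sym c u v) }
  module T = Embedding (λ x → x) (λ e → e) (λ e → e) c c' ι ι-inj (λ u v → refl)

spanning-supergraph : ∀ {n k} {A B : Graph n} → (∀ {a b} → adj A a b ≡ true → adj B a b ≡ true) →
  (c : Coloring A k) → Is3Rainbow c → Σ (Coloring B k) Is3Rainbow
spanning-supergraph {k = k} {B = B} A⊆B c rainbow = c' , λ x y z xy yz xz → T.rainbowTree-map (rainbow x y z xy yz xz)
  where
  c' : Coloring B k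
  c' = record { col = col c ; col-sym = col-sym c }
  module T = Embedding (λ x → x) (λ e → e) A⊆B c c' (λ x → x) (λ e → e) (λ u v → refl)

module _ {n} {H : Graph n} where
  reverseE : List (Edge n) → List (Edge n)
  reverseE = map (λ e → proj₂ e , proj₁ e)

  path-start∈ : ∀ {u v W E} → Path H u v W E → u ∈ W
  path-start∈ (here v) = here refl
  path-start∈ (step _ _ _) = here refl

  path-end∈ : ∀ {u v W E} → Path H u v W E → v ∈ W
  path-end∈ (here v) = here refl
  path-end∈ (step _ _ P) = there (path-end∈ P)

  -- The path is grown backwards from its end, so its edges are reversed.
  path-tree : ∀ {u v W E} → Path H u v W E → Tree H W (reverseE E)
  path-tree (here v) = single v
  path-tree (step {u} {w} a u∉ P) = grow (path-tree P) (path-start∈ P) u∉ (trans (Graph.sym H w u) a)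

  colors-reverse : ∀ {k} (c : Coloring H k) → ∀ E → colors c (reverseE E) ≡ colors c E
  colors-reverse c [] = refl
  colors-reverse c ((u , v) ∷ E) = cong₂ _∷_ (col-sym c v u) (colors-reverse c E)

  rainbow-path-tree : ∀ {k} (c : Coloring H k) → IsRainbowConnected c → ∀ x y → x ≢ y →
    Σ (List (Fin n)) λ W → Σ (List (Edge n)) λ E → Tree H W E × Unique (colors c E) × x ∈ W × y ∈ W
  rainbow-path-tree c rc x y x≢y with rc x y x≢y
  ... | W , E , P , U =
    W , reverseE E , path-tree P , subst Unique (≡-sym (colors-reverse c E)) U , path-start∈ P , path-end∈ P

Third : ∀ {n} → Fin n → Fin n → Set
Third {n} x y = Σ (Fin n) λ z → (x ≢ z) × (y ≢ z)

ThreeVertices : ℕ → Set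
ThreeVertices n = Σ (Fin n) λ p → Σ (Fin n) λ q → Σ (Fin n) λ r → Distinct3 p q r

-- If there are three distinct vertices, every two vertices have a third one:
-- one of p, q, r avoids both.
third-vertex : ∀ {n} → ThreeVertices n → (x y : Fin n) → Third x y
third-vertex (p , q , r , pq , qr , pr) x y with x ≟F p | y ≟F p | x ≟F q | y ≟F q
... | no xp | no yp | _ | _ = p , xp , yp
... | _ | _ | no xq | no yq = q , xq , yq
... | yes refl | _ | yes refl | _ = ⊥-elim (pq refl)
... | _ | yes refl | _ | yes refl = ⊥-elim (pq refl)
... | yes refl | _ | _ | yes refl = r , pr , qr
... | _ | yes refl | yes refl | _ = r , qr , pr

three-vertices : ∀ {n} → 3 ≤ n → ThreeVertices n
three-vertices {suc (suc (suc n))} (s≤s (s≤s (s≤s _))) = fz , fs fz , fs (fs fz) , (λ ()) , (λ ()) , (λ ())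

-- A connected non-complete graph has two non-adjacent vertices u, v; the
-- second vertex w on a path from u to v completes a triple.
nonComplete-three-vertices : ∀ {t} (H : Graph t) → Connected H → ¬ Complete H → ThreeVertices t
nonComplete-three-vertices {t} H connected nonComplete
  with ¬∀⟶∃¬ t _ (λ u → all? (λ v → ¬? (u ≟F v) →-dec (adj H u v ≟B true))) nonComplete
... | u , u-not-universal with ¬∀⟶∃¬ t _ (λ v → ¬? (u ≟F v) →-dec (adj H u v ≟B true)) u-not-universal
... | v , ¬uv with connected u v
... | _ , _ , here _ = ⊥-elim (¬uv (λ u≢u → ⊥-elim (u≢u refl)))
... | _ , _ , step {w = w} uw _ _ = u , w , v , u≢w , w≢v , u≢v
  where
  u≢v : u ≢ v
  u≢v e = ¬uv (λ u≢v → ⊥-elim (u≢v e))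
  u≢w : u ≢ w
  u≢w refl with trans (≡-sym uw) (irrefl H u)
  ... | ()
  w≢v : w ≢ v
  w≢v refl = ¬uv (λ _ → uw)

module Join (s t : ℕ) where
  L : Fin s → Fin (s + t)
  L i = i ↑ˡ t
  R : Fin t → Fin (s + t)
  R j = s ↑ʳ j

  L-inj : ∀ {a b} → L a ≡ L b → a ≡ b
  L-inj {a} {b} = ↑ˡ-injective t a b
  R-inj : ∀ {a b} → R a ≡ R b → a ≡ b
  R-inj {a} {b} = ↑ʳ-injective s a b

  L≢R : ∀ {a b} → L a ≢ R b
  L≢R {a} {b} eq with trans (≡-sym (splitAt-↑ˡ s a t)) (trans (cong (splitAt s) eq) (splitAt-↑ʳ s t b))
  ... | ()

  R≢L : ∀ {a b} → R b ≢ L a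
  R≢L eq = L≢R (≡-sym eq)

  L∉mapR : ∀ a W → L a ∉ map R W
  L∉mapR a W L∈ with ∈-map⁻ R L∈
  ... | _ , _ , e = L≢R e

  data View : Fin (s + t) → Set where
    left  : (i : Fin s) → View (L i)
    right : (j : Fin t) → View (R j)

  view : ∀ u → View u
  view u with splitAt s u in eq
  ... | inj₁ i = subst View (splitAt⁻¹-↑ˡ eq) (left i)
  ... | inj₂ j = subst View (splitAt⁻¹-↑ʳ eq) (right j)

  module _ (G : Graph s) (H : Graph t) where
    adj-LL : ∀ a b → adj (G ∨G H) (L a) (L b) ≡ adj G a b
    adj-LL a b rewrite splitAt-↑ˡ s a t | splitAt-↑ˡ s b t = refl
    adj-RR : ∀ a b → adj (G ∨G H) (R a) (R b) ≡ adj H a b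
    adj-RR a b rewrite splitAt-↑ʳ s t a | splitAt-↑ʳ s t b = refl
    adj-LR : ∀ a b → adj (G ∨G H) (L a) (R b) ≡ true
    adj-LR a b rewrite splitAt-↑ˡ s a t | splitAt-↑ʳ s t b = refl
    adj-RL : ∀ a b → adj (G ∨G H) (R b) (L a) ≡ true
    adj-RL a b rewrite splitAt-↑ˡ s a t | splitAt-↑ʳ s t b = refl

  module _ {k : ℕ} (F : Fin s ⊎ Fin t → Fin s ⊎ Fin t → Fin k) where
    colOf : Fin (s + t) → Fin (s + t) → Fin k
    colOf u v = F (splitAt s u) (splitAt s v)
    col-LL : ∀ a b → colOf (L a) (L b) ≡ F (inj₁ a) (inj₁ b)
    col-LL a b = cong₂ F (splitAt-↑ˡ s a t) (splitAt-↑ˡ s b t)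
    col-RR : ∀ a b → colOf (R a) (R b) ≡ F (inj₂ a) (inj₂ b)
    col-RR a b = cong₂ F (splitAt-↑ʳ s t a) (splitAt-↑ʳ s t b)
    col-LR : ∀ a b → colOf (L a) (R b) ≡ F (inj₁ a) (inj₂ b)
    col-LR a b = cong₂ F (splitAt-↑ˡ s a t) (splitAt-↑ʳ s t b)
    col-RL : ∀ a b → colOf (R b) (L a) ≡ F (inj₂ b) (inj₁ a)
    col-RL a b = cong₂ F (splitAt-↑ʳ s t b) (splitAt-↑ˡ s a t)

  joinColoring : ∀ {k} (G : Graph s) (H : Graph t) (F : Fin s ⊎ Fin t → Fin s ⊎ Fin t → Fin k) →
    (∀ p q → F p q ≡ F q p) → Coloring (G ∨G H) k
  joinColoring G H F F-sym = record { col = colOf F ; col-sym = λ u v → F-sym _ _ }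

  join-3rainbow : ∀ {k} {G : Graph s} {H : Graph t} (c : Coloring (G ∨G H) k) →
    (∀ a b d → Distinct3 a b d → RainbowTreeOn (G ∨G H) c (L a) (L b) (L d)) →
    (∀ a b d → Distinct3 a b d → RainbowTreeOn (G ∨G H) c (R a) (R b) (R d)) →
    (∀ a b w → a ≢ b → RainbowTreeOn (G ∨G H) c (L a) (L b) (R w)) →
    (∀ a b w → a ≢ b → RainbowTreeOn (G ∨G H) c (R a) (R b) (L w)) →
    Is3Rainbow c
  join-3rainbow c LLL RRR LLR RRL x y z x≢y y≢z x≢z with view x | view y | view z
  ... | left a  | left b  | left d  = LLL a b d ((λ e → x≢y (cong L e)) , (λ e → y≢z (cong L e)) , (λ e → x≢z (cong L e)))
  ... | right a | right b | right d = RRR a b d ((λ e → x≢y (cong R e)) , (λ e → y≢z (cong R e)) , (λ e → x≢z (cong R e)))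
  ... | left a  | left b  | right d = LLR a b d (λ e → x≢y (cong L e))
  ... | left a  | right b | left d  = swap₂₃ c (LLR a d b (λ e → x≢z (cong L e)))
  ... | right a | left b  | left d  = rotateʳ c (LLR b d a (λ e → y≢z (cong L e)))
  ... | right a | right b | left d  = RRL a b d (λ e → x≢y (cong R e))
  ... | right a | left b  | right d = swap₂₃ c (RRL a d b (λ e → x≢z (cong R e)))
  ... | left a  | right b | right d = rotateʳ c (RRL b d a (λ e → y≢z (cong R e)))

K⊆join : ∀ {s t} (G : Graph s) (H : Graph t) {u v} → adj (K s t) u v ≡ true → adj (G ∨G H) u v ≡ true
K⊆join {s} {t} G H {u} {v} e with Join.view s t u | Join.view s t v
... | Join.left i  | Join.right j = Join.adj-LR s t G H i j
... | Join.right j | Join.left i  = Join.adj-RL s t G H i j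
... | Join.left i  | Join.left j  with trans (≡-sym e) (Join.adj-LL s t (Empty s) (Empty t) i j)
...   | ()
K⊆join {s} {t} G H e | Join.right i | Join.right j with trans (≡-sym e) (Join.adj-RR s t (Empty s) (Empty t) i j)
...   | ()

bound-by-K : ∀ {s t} (G : Graph s) (H : Graph t) → ∀ k b → IsRx3 (K s t) k → IsRx3 (G ∨G H) b → b ≤ k
bound-by-K G H k b ((c , rainbow) , _) (_ , minimal) = minimal k (spanning-supergraph (K⊆join G H) c rainbow)

module Palette (k m : ℕ) where
  old : Fin k → Fin (k + m)
  old a = a ↑ˡ m
  new : Fin m → Fin (k + m)
  new i = k ↑ʳ i

  old-inj : ∀ {a b} → old a ≡ old b → a ≡ b
  old-inj {a} {b} = ↑ˡ-injective m a b
  new-inj : ∀ {i j} → new i ≡ new j → i ≡ j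
  new-inj {i} {j} = ↑ʳ-injective k i j
  new-not-old : ∀ i a → new i ≢ old a
  new-not-old i a e with trans (≡-sym (splitAt-↑ʳ k m i)) (trans (cong (splitAt k) e) (splitAt-↑ˡ k a m))
  ... | ()

-- Every two distinct vertices have a third one (true unless n = 2).
HasThirds : ℕ → Set
HasThirds n = ∀ (x y : Fin n) → x ≢ y → Third x y

module NewCrossColour {s t k} (G : Graph s) (H : Graph t)
  (cG : Coloring G k) (rG : Is3Rainbow cG) (cH : Coloring H k) (rH : Is3Rainbow cH)
  (thirdG : HasThirds s) (thirdH : HasThirds t) where
  open Join s t
  open Palette k 1

  ν : Fin (k + 1)
  ν = new fz

  F : Fin s ⊎ Fin t → Fin s ⊎ Fin t → Fin (k + 1)
  F (inj₁ a) (inj₁ b) = old (col cG a b)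
  F (inj₂ a) (inj₂ b) = old (col cH a b)
  F (inj₁ _) (inj₂ _) = ν
  F (inj₂ _) (inj₁ _) = ν

  F-sym : ∀ p q → F p q ≡ F q p
  F-sym (inj₁ a) (inj₁ b) = cong old (col-sym cG a b)
  F-sym (inj₂ a) (inj₂ b) = cong old (col-sym cH a b)
  F-sym (inj₁ _) (inj₂ _) = refl
  F-sym (inj₂ _) (inj₁ _) = refl

  c : Coloring (G ∨G H) (k + 1)
  c = joinColoring G H F F-sym

  module ViaG = Embedding L L-inj (λ {a} {b} e → trans (adj-LL G H a b) e) cG c old old-inj (col-LL F)
  module ViaH = Embedding R R-inj (λ {a} {b} e → trans (adj-RR G H a b) e) cH c old old-inj (col-RR F)

  -- Two vertices i, j of G and w of H: a rainbow tree of G through i, j and a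
  -- third vertex, plus the pendant cross edge i w of the new colour.
  LLR : ∀ i j w → i ≢ j → RainbowTreeOn (G ∨G H) c (L i) (L j) (R w)
  LLR i j w i≢j with thirdG i j i≢j
  ... | z , i≢z , j≢z with rG i j z i≢j j≢z i≢z
  ... | W , E , T , U , i∈ , j∈ , _ with ViaG.add-leaf T U i∈ (λ _ → R≢L) (adj-LR G H i w)
                                           (λ a e → new-not-old fz a (trans (≡-sym (col-LR F i w)) e))
  ... | T' , U' = _ , _ , T' , U' , there (∈-map⁺ L i∈) , there (∈-map⁺ L j∈) , here refl

  RRL : ∀ i j w → i ≢ j → RainbowTreeOn (G ∨G H) c (R i) (R j) (L w)
  RRL i j w i≢j with thirdH i j i≢j
  ... | z , i≢z , j≢z with rH i j z i≢j j≢z i≢z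
  ... | W , E , T , U , i∈ , j∈ , _ with ViaH.add-leaf T U i∈ (λ _ → L≢R) (adj-RL G H w i)
                                           (λ a e → new-not-old fz a (trans (≡-sym (col-RL F w i)) e))
  ... | T' , U' = _ , _ , T' , U' , there (∈-map⁺ R i∈) , there (∈-map⁺ R j∈) , here refl

  rainbow : Is3Rainbow c
  rainbow = join-3rainbow c
    (λ a b d (ab , bd , ad) → ViaG.rainbowTree-map (rG a b d ab bd ad))
    (λ a b d (ab , bd , ad) → ViaH.rainbowTree-map (rH a b d ab bd ad))
    LLR RRL

new-cross-colour : ∀ {s t k} (G : Graph s) (H : Graph t) → HasThirds s → HasThirds t →
  (cG : Coloring G k) → Is3Rainbow cG → (cH : Coloring H k) → Is3Rainbow cH →
  Σ (Coloring (G ∨G H) (k + 1)) Is3Rainbow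
new-cross-colour G H thirdG thirdH cG rG cH rH = NewCrossColour.c G H cG rG cH rH thirdG thirdH
                                             , NewCrossColour.rainbow G H cG rG cH rH thirdG thirdH

-- Part (1): G = K₁, so H is not complete and has three vertices; G gets the
-- (vacuously 3-rainbow) colouring by any colour of H's palette.
part1 : ∀ {t} (G : Graph 1) (H : Graph t) → Connected H → (¬ Complete G ⊎ ¬ Complete H) →
  ∀ h b → IsRx3 H h → IsRx3 (G ∨G H) b → b ≤ h + 1
part1 {t} G H connected nonComplete h b ((cH , rH) , _) (_ , minimal) =
  minimal (h + 1) (new-cross-colour G H thirdG (λ x y _ → third-vertex vertices x y) cG rG cH rH)
  where
  G-complete : Complete G
  G-complete fz fz ne = ⊥-elim (ne refl)
  vertices : ThreeVertices t
  vertices = nonComplete-three-vertices H connected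
    ([ (λ ¬cG → ⊥-elim (¬cG G-complete)) , (λ ¬cH → ¬cH) ]′ nonComplete)
  cG : Coloring G h
  cG = record { col = λ _ _ → col cH (proj₁ vertices) (proj₁ vertices) ; col-sym = λ _ _ → refl }
  rG : Is3Rainbow cG
  rG fz fz _ ne _ _ = ⊥-elim (ne refl)
  thirdG : HasThirds 1
  thirdG fz fz ne = ⊥-elim (ne refl)

-- Part (3): both sides have at least three vertices; embed both palettes into
-- Fin (g ⊔ h) and add one colour.  The K_{s,t} bound is bound-by-K.
part3 : ∀ {s t} (G : Graph s) (H : Graph t) → 3 ≤ s → s ≤ t →
  ∀ g h b → IsRx3 G g → IsRx3 H h → IsRx3 (G ∨G H) b → b ≤ (g ⊔ h) + 1
part3 G H 3≤s s≤t g h b ((cG , rG) , _) ((cH , rH) , _) (_ , minimal)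
  with recolour (λ a → inject≤ a (m≤m⊔n g h)) (λ {a} {b} e → inject≤-injective _ _ a b e) cG rG
     | recolour (λ a → inject≤ a (m≤n⊔m g h)) (λ {a} {b} e → inject≤-injective _ _ a b e) cH rH
... | cG' , rG' | cH' , rH' =
  minimal ((g ⊔ h) + 1) (new-cross-colour G H (λ x y _ → third-vertex (three-vertices 3≤s) x y)
                            (λ x y _ → third-vertex (three-vertices (≤-trans 3≤s s≤t)) x y) cG' rG' cH' rH')

module JoinWithK₂ {t r : ℕ} (G : Graph 2) (H : Graph t) (connected : Connected G)
  (cH : Coloring H r) (rcH : IsRainbowConnected cH) where
  open Join 2 t
  open DecMembership (_≟F_ {t}) using (_∈?_)

  edge : adj G fz (fs fz) ≡ true
  edge with connected fz (fs fz)
  ... | _ , _ , step {w = fs fz} a _ _ = a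
  ... | _ , _ , step {w = fz} a _ _ with trans (≡-sym a) (irrefl G fz)
  ...   | ()

  edge-L : ∀ a b → a ≢ b → adj (G ∨G H) (L a) (L b) ≡ true
  edge-L fz fz a≢b = ⊥-elim (a≢b refl)
  edge-L fz (fs fz) _ = trans (adj-LL G H fz (fs fz)) edge
  edge-L (fs fz) fz _ = trans (adj-LL G H (fs fz) fz) (trans (Graph.sym G (fs fz) fz) edge)
  edge-L (fs fz) (fs fz) a≢b = ⊥-elim (a≢b refl)

  open Palette r 3

  α : Fin (r + 3)
  α = new fz
  ν : Fin 2 → Fin (r + 3)
  ν a = new (fs a)

  ν≢α : ∀ a → ν a ≢ α
  ν≢α a e with new-inj e
  ... | ()
  one≢zero : fs {1} fz ≢ fz
  one≢zero ()
  ν₀≢ν₁ : ν fz ≢ ν (fs fz)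
  ν₀≢ν₁ e with new-inj e
  ... | ()

  F : Fin 2 ⊎ Fin t → Fin 2 ⊎ Fin t → Fin (r + 3)
  F (inj₁ _) (inj₁ _) = α
  F (inj₂ a) (inj₂ b) = old (col cH a b)
  F (inj₁ a) (inj₂ _) = ν a
  F (inj₂ _) (inj₁ a) = ν a

  F-sym : ∀ p q → F p q ≡ F q p
  F-sym (inj₁ a) (inj₁ b) = refl
  F-sym (inj₂ a) (inj₂ b) = cong old (col-sym cH a b)
  F-sym (inj₁ _) (inj₂ _) = refl
  F-sym (inj₂ _) (inj₁ _) = refl

  c : Coloring (G ∨G H) (r + 3)
  c = joinColoring G H F F-sym

  module ViaH = Embedding R R-inj (λ {a} {b} e → trans (adj-RR G H a b) e) cH c old old-inj (col-RR F)

  with-colour : ∀ {κ cs} u v → col c u v ≡ κ → All (κ ≢_) cs → All (col c u v ≢_) cs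
  with-colour u v e = All.map (λ κ≢ e' → κ≢ (trans (≡-sym e) e'))

  differs : ∀ {κ κ'} p q → col c p q ≡ κ' → κ ≢ κ' → κ ≢ col c p q
  differs p q e κ≢κ' e' = κ≢κ' (trans e' e)

  new-fresh : ∀ i E → All (new i ≢_) (colors c (ViaH.mapE E))
  new-fresh i = ViaH.fresh-colour (new i) (new-not-old i)

  LLR : ∀ a b w → a ≢ b → RainbowTreeOn (G ∨G H) c (L a) (L b) (R w)
  LLR a b w a≢b = path₂ (L a) (L b) (R w) (λ e → a≢b (L-inj e)) L≢R L≢R (edge-L a b a≢b) (adj-LR G H b w)
    (λ e → ν≢α b (trans (≡-sym (col-LR F b w)) (trans (≡-sym e) (col-LL F a b))))
    where open SmallTrees c

  RRL : ∀ x y a → x ≢ y → RainbowTreeOn (G ∨G H) c (R x) (R y) (L a)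
  RRL x y a x≢y with rainbow-path-tree cH rcH x y x≢y
  ... | W , E , T , U , x∈ , y∈ with ViaH.add-leaf T U x∈ (λ _ → L≢R) (adj-RL G H a x)
                                         (λ b e → new-not-old (fs a) b (trans (≡-sym (col-RL F a x)) e))
  ... | T' , U' = _ , _ , T' , U' , there (∈-map⁺ R x∈) , there (∈-map⁺ R y∈) , here refl

  -- Three vertices x, y, z of H: take a rainbow x–y path; if it misses z,
  -- continue it by the detour x – 0 – 1 – z of colours ν₀, α, ν₁.
  RRR : ∀ x y z → Distinct3 x y z → RainbowTreeOn (G ∨G H) c (R x) (R y) (R z)
  RRR x y z (x≢y , _ , _) with rainbow-path-tree cH rcH x y x≢y
  ... | W , E , T , U , x∈ , y∈ with z ∈? W
  ... | yes z∈ = ViaH.rainbowTree-map (W , E , T , U , x∈ , y∈ , z∈)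
  ... | no z∉ = _ , _ , proj₁ x01z , proj₂ x01z ,
                there (there (there (∈-map⁺ R x∈))) , there (there (there (∈-map⁺ R y∈))) , here refl
    where
    x0 : RainbowTree (G ∨G H) c (L fz ∷ map R W) ((R x , L fz) ∷ ViaH.mapE E)
    x0 = ViaH.add-leaf T U x∈ (λ _ → L≢R) (adj-RL G H fz x)
           (λ b e → new-not-old (fs fz) b (trans (≡-sym (col-RL F fz x)) e))
    x01 : RainbowTree (G ∨G H) c (L (fs fz) ∷ L fz ∷ map R W) ((L fz , L (fs fz)) ∷ (R x , L fz) ∷ ViaH.mapE E)
    x01 = extend-rainbow c (proj₁ x0) (proj₂ x0) (here refl)
            (λ { (here e) → one≢zero (L-inj e) ; (there R∈) → L∉mapR (fs fz) W R∈ })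
            (edge-L fz (fs fz) (λ ()))
            (with-colour (L fz) (L (fs fz)) (col-LL F fz (fs fz))
              (differs (R x) (L fz) (col-RL F fz x) (λ e → ν≢α fz (≡-sym e)) All.∷ new-fresh fz E))
    x01z : RainbowTree (G ∨G H) c (R z ∷ L (fs fz) ∷ L fz ∷ map R W)
             ((L (fs fz) , R z) ∷ (L fz , L (fs fz)) ∷ (R x , L fz) ∷ ViaH.mapE E)
    x01z = extend-rainbow c (proj₁ x01) (proj₂ x01) (here refl)
             (λ { (here e) → L≢R (≡-sym e) ; (there (here e)) → L≢R (≡-sym e) ; (there (there R∈)) → ViaH.∉-map z∉ R∈ })
             (adj-LR G H (fs fz) z)
             (with-colour (L (fs fz)) (R z) (col-LR F (fs fz) z)
               (differs (L fz) (L (fs fz)) (col-LL F fz (fs fz)) (ν≢α (fs fz)) All.∷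
                differs (R x) (L fz) (col-RL F fz x) (λ e → ν₀≢ν₁ (≡-sym e)) All.∷ new-fresh (fs (fs fz)) E))

  rainbow : Is3Rainbow c
  rainbow = join-3rainbow c (λ a b d → no-three a b d) RRR LLR RRL
    where
    no-three : ∀ a b d → Distinct3 a b d → RainbowTreeOn (G ∨G H) c (L a) (L b) (L d)
    no-three fz fz _ (ab , _ , _) = ⊥-elim (ab refl)
    no-three fz (fs fz) fz (_ , _ , ad) = ⊥-elim (ad refl)
    no-three fz (fs fz) (fs fz) (_ , bd , _) = ⊥-elim (bd refl)
    no-three (fs fz) fz fz (_ , bd , _) = ⊥-elim (bd refl)
    no-three (fs fz) fz (fs fz) (_ , _ , ad) = ⊥-elim (ad refl)
    no-three (fs fz) (fs fz) _ (ab , _ , _) = ⊥-elim (ab refl)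

part2 : ∀ {t} (G : Graph 2) (H : Graph t) → Connected G →
  ∀ r b → IsRc H r → IsRx3 (G ∨G H) b → b ≤ r + 3
part2 G H connected r b ((cH , rcH) , _) (_ , minimal) =
  minimal (r + 3) (JoinWithK₂.c G H connected cH rcH , JoinWithK₂.rainbow G H connected cH rcH)

compare-colour : ∀ {s} → Fin s → Fin s → Fin 3
compare-colour i j with <-cmp i j
... | tri< _ _ _ = fz
... | tri≈ _ _ _ = fs fz
... | tri> _ _ _ = fs (fs fz)

module _ {s} {i j : Fin s} where
  compare-< : i < j → compare-colour i j ≡ fz
  compare-< i<j with <-cmp i j
  ... | tri< _ _ _ = refl
  ... | tri≈ _ i≡j _ = ⊥-elim (<-irrefl i≡j i<j)
  ... | tri> _ _ j<i = ⊥-elim (<-asym i<j j<i)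

  compare-> : j < i → compare-colour i j ≡ fs (fs fz)
  compare-> j<i with <-cmp i j
  ... | tri< i<j _ _ = ⊥-elim (<-asym j<i i<j)
  ... | tri≈ _ i≡j _ = ⊥-elim (<-irrefl (≡-sym i≡j) j<i)
  ... | tri> _ _ _ = refl

compare-≡ : ∀ {s} (i : Fin s) → compare-colour i i ≡ fs fz
compare-≡ i with <-cmp i i
... | tri< i<i _ _ = ⊥-elim (<-irrefl refl i<i)
... | tri≈ _ _ _ = refl
... | tri> _ _ i<i = ⊥-elim (<-irrefl refl i<i)

reverse-outcome : Fin 3 → Fin 3
reverse-outcome fz = fs (fs fz)
reverse-outcome (fs fz) = fs fz
reverse-outcome (fs (fs fz)) = fz

reverse-outcome-inj : ∀ {a b} → reverse-outcome a ≡ reverse-outcome b → a ≡ b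
reverse-outcome-inj {fz} {fz} _ = refl
reverse-outcome-inj {fs fz} {fs fz} _ = refl
reverse-outcome-inj {fs (fs fz)} {fs (fs fz)} _ = refl
reverse-outcome-inj {fz} {fs fz} ()
reverse-outcome-inj {fz} {fs (fs fz)} ()
reverse-outcome-inj {fs fz} {fz} ()
reverse-outcome-inj {fs fz} {fs (fs fz)} ()
reverse-outcome-inj {fs (fs fz)} {fz} ()
reverse-outcome-inj {fs (fs fz)} {fs fz} ()

compare-swap : ∀ {s} (i j : Fin s) → compare-colour j i ≡ reverse-outcome (compare-colour i j)
compare-swap i j with <-cmp i j
... | tri< i<j _ _ = compare-> i<j
... | tri≈ _ refl _ = compare-≡ i
... | tri> _ _ j<i = compare-< j<i

module _ {A : Set} {a b d : A} where
  distinct-swap₁₂ : Distinct3 a b d → Distinct3 b a d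
  distinct-swap₁₂ (ab , bd , ad) = ≢-sym ab , ad , bd
  distinct-swap₂₃ : Distinct3 a b d → Distinct3 a d b
  distinct-swap₂₃ (ab , bd , ad) = ad , ≢-sym bd , ab
  distinct-reverse : Distinct3 a b d → Distinct3 d b a
  distinct-reverse (ab , bd , ad) = ≢-sym bd , ≢-sym ab , ≢-sym ad

median-separates : ∀ {s} {i j l : Fin s} → i < j → j < l →
  Distinct3 (compare-colour i j) (compare-colour j j) (compare-colour l j)
median-separates {j = j} i<j j<l rewrite compare-< i<j | compare-≡ j | compare-> j<l = (λ ()) , (λ ()) , (λ ())

-- Any three distinct indices are separated by comparison with their median.
separator : ∀ {s} (i j l : Fin s) → Distinct3 i j l →
  Σ (Fin s) λ m → Distinct3 (compare-colour i m) (compare-colour j m) (compare-colour l m)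
separator i j l (ij , jl , il) with <-cmp i j | <-cmp j l
... | tri≈ _ i≡j _ | _ = ⊥-elim (ij i≡j)
... | _ | tri≈ _ j≡l _ = ⊥-elim (jl j≡l)
... | tri< i<j _ _ | tri< j<l _ _ = j , median-separates i<j j<l
... | tri> _ _ j<i | tri> _ _ l<j = j , distinct-reverse (median-separates l<j j<i)
... | tri< i<j _ _ | tri> _ _ l<j with <-cmp i l
...   | tri< i<l _ _ = l , distinct-swap₂₃ (median-separates i<l l<j)
...   | tri≈ _ i≡l _ = ⊥-elim (il i≡l)
...   | tri> _ _ l<i = i , distinct-swap₂₃ (distinct-swap₁₂ (median-separates l<i i<j))
separator i j l (ij , jl , il) | tri> _ _ j<i | tri< j<l _ _ with <-cmp i l
...   | tri< i<l _ _ = i , distinct-swap₁₂ (median-separates j<i i<l)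
...   | tri≈ _ i≡l _ = ⊥-elim (il i≡l)
...   | tri> _ _ l<i = l , distinct-swap₂₃ (distinct-reverse (median-separates j<l l<i))

module BalancedBipartite (s : ℕ) where
  open Join s s

  F : Fin s ⊎ Fin s → Fin s ⊎ Fin s → Fin 3
  F (inj₁ i) (inj₂ j) = compare-colour i j
  F (inj₂ j) (inj₁ i) = compare-colour i j
  F (inj₁ _) (inj₁ _) = fz
  F (inj₂ _) (inj₂ _) = fz

  F-sym : ∀ p q → F p q ≡ F q p
  F-sym (inj₁ i) (inj₂ j) = refl
  F-sym (inj₂ j) (inj₁ i) = refl
  F-sym (inj₁ _) (inj₁ _) = refl
  F-sym (inj₂ _) (inj₂ _) = refl

  c : Coloring (K s s) 3
  c = joinColoring (Empty s) (Empty s) F F-sym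

  -- The argument is symmetric in the two sides: P is one side, Q the other,
  -- and the colour of P i – Q j is φ (compare-colour i j) for an injective φ.
  module Side (P Q : Fin s → Fin (s + s))
    (P-inj : ∀ {a b} → P a ≡ P b → a ≡ b) (Q-inj : ∀ {a b} → Q a ≡ Q b → a ≡ b)
    (P≢Q : ∀ i j → P i ≢ Q j) (P–Q : ∀ i j → adj (K s s) (P i) (Q j) ≡ true)
    (φ : Fin 3 → Fin 3) (φ-inj : ∀ {a b} → φ a ≡ φ b → a ≡ b)
    (col-PQ : ∀ i j → col c (P i) (Q j) ≡ φ (compare-colour i j)) where
    open SmallTrees c

    col-QP : ∀ i j → col c (Q j) (P i) ≡ φ (compare-colour i j)
    col-QP i j = trans (col-sym c (Q j) (P i)) (col-PQ i j)
    Q–P : ∀ i j → adj (K s s) (Q j) (P i) ≡ true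
    Q–P i j = trans (Graph.sym (K s s) (Q j) (P i)) (P–Q i j)
    Q≢P : ∀ i j → Q j ≢ P i
    Q≢P i j e = P≢Q i j (≡-sym e)
    P-≢ : ∀ {i j} → i ≢ j → P i ≢ P j
    P-≢ i≢j e = i≢j (P-inj e)
    Q-≢ : ∀ {i j} → i ≢ j → Q i ≢ Q j
    Q-≢ i≢j e = i≢j (Q-inj e)

    colour-PQ : ∀ {i j o} → compare-colour i j ≡ o → col c (P i) (Q j) ≡ φ o
    colour-PQ {i} {j} e = trans (col-PQ i j) (cong φ e)
    colour-QP : ∀ {i j o} → compare-colour i j ≡ o → col c (Q j) (P i) ≡ φ o
    colour-QP {i} {j} e = trans (col-QP i j) (cong φ e)

    outcomes-differ : ∀ {κ κ' a b} → κ ≡ φ a → κ' ≡ φ b → a ≢ b → κ ≢ κ'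
    outcomes-differ eκ eκ' a≢b e = a≢b (φ-inj (trans (≡-sym eκ) (trans e eκ')))

    PPP : ∀ i j l → Distinct3 i j l → RainbowTreeOn (K s s) c (P i) (P j) (P l)
    PPP i j l (ij , jl , il) with separator i j l (ij , jl , il)
    ... | m , (d₁ , d₂ , d₃) =
      star (Q m) (P i) (P j) (P l) (P≢Q i m) (P≢Q j m) (P≢Q l m) (P-≢ ij , P-≢ jl , P-≢ il)
        (Q–P i m) (Q–P j m) (Q–P l m)
        ( outcomes-differ (col-QP i m) (col-QP j m) d₁
        , outcomes-differ (col-QP j m) (col-QP l m) d₂
        , outcomes-differ (col-QP i m) (col-QP l m) d₃)

    PPQ< : ∀ {i l} → i < l → ∀ j → RainbowTreeOn (K s s) c (P i) (P l) (Q j)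
    PPQ< {i} {l} i<l j with <-cmp j i
    ... | tri< j<i _ _ =
      path₃ (Q j) (P i) (Q l) (P l) (Q≢P i j) (Q-≢ (<⇒≢ (<-trans j<i i<l))) (Q≢P l j) (P≢Q i l)
        (P-≢ (<⇒≢ i<l)) (Q≢P l l) (Q–P i j) (P–Q i l) (Q–P l l)
        ( outcomes-differ (colour-QP (compare-> j<i)) (colour-PQ (compare-< i<l)) (λ ())
        , outcomes-differ (colour-PQ (compare-< i<l)) (colour-QP (compare-≡ l)) (λ ())
        , outcomes-differ (colour-QP (compare-> j<i)) (colour-QP (compare-≡ l)) (λ ()))
    ... | tri≈ _ refl _ =
      swap₂₃ c (path₂ (P j) (Q j) (P l) (P≢Q j j) (Q≢P l j) (P-≢ (<⇒≢ i<l)) (P–Q j j) (Q–P l j)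
        (outcomes-differ (colour-PQ (compare-≡ j)) (colour-QP (compare-> i<l)) (λ ())))
    ... | tri> _ _ i<j with <-cmp j l
    ...   | tri< j<l _ _ =
      swap₂₃ c (path₂ (P i) (Q j) (P l) (P≢Q i j) (Q≢P l j) (P-≢ (<⇒≢ i<l)) (P–Q i j) (Q–P l j)
        (outcomes-differ (colour-PQ (compare-< i<j)) (colour-QP (compare-> j<l)) (λ ())))
    ...   | tri≈ _ refl _ =
      swap₂₃ c (path₂ (P i) (Q j) (P j) (P≢Q i j) (Q≢P j j) (P-≢ (<⇒≢ i<l)) (P–Q i j) (Q–P j j)
        (outcomes-differ (colour-PQ (compare-< i<j)) (colour-QP (compare-≡ j)) (λ ())))
    ...   | tri> _ _ l<j =
      path₃ (Q j) (P i) (Q i) (P l) (Q≢P i j) (Q-≢ (λ e → <⇒≢ i<j (≡-sym e))) (Q≢P l j) (P≢Q i i)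
        (P-≢ (<⇒≢ i<l)) (Q≢P l i) (Q–P i j) (P–Q i i) (Q–P l i)
        ( outcomes-differ (colour-QP (compare-< i<j)) (colour-PQ (compare-≡ i)) (λ ())
        , outcomes-differ (colour-PQ (compare-≡ i)) (colour-QP (compare-> i<l)) (λ ())
        , outcomes-differ (colour-QP (compare-< i<j)) (colour-QP (compare-> i<l)) (λ ()))

    PPQ : ∀ i l j → i ≢ l → RainbowTreeOn (K s s) c (P i) (P l) (Q j)
    PPQ i l j i≢l with <-cmp i l
    ... | tri< i<l _ _ = PPQ< i<l j
    ... | tri≈ _ i≡l _ = ⊥-elim (i≢l i≡l)
    ... | tri> _ _ l<i = swap₁₂ c (PPQ< l<i j)

  module LeftSide = Side L R L-inj R-inj (λ i j → L≢R) (λ i j → adj-LR (Empty s) (Empty s) i j)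
                      (λ a → a) (λ e → e) (λ i j → col-LR F i j)
  module RightSide = Side R L R-inj L-inj (λ i j → R≢L) (λ i j → adj-RL (Empty s) (Empty s) j i)
                       reverse-outcome reverse-outcome-inj (λ i j → trans (col-RL F j i) (compare-swap i j))

  rainbow : Is3Rainbow c
  rainbow = join-3rainbow c LeftSide.PPP RightSide.PPP LeftSide.PPQ RightSide.PPQ

no-three-colours : ∀ {k} → k ≤ 2 → (a b d : Fin k) → Distinct3 a b d → ⊥
no-three-colours {suc (suc (suc k))} (s≤s (s≤s ())) _ _ _
no-three-colours {suc zero} _ fz fz _ (ab , _ , _) = ab refl
no-three-colours {suc (suc zero)} _ fz fz _ (ab , _ , _) = ab refl
no-three-colours {suc (suc zero)} _ (fs fz) (fs fz) _ (ab , _ , _) = ab refl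
no-three-colours {suc (suc zero)} _ fz (fs fz) fz (_ , _ , ad) = ad refl
no-three-colours {suc (suc zero)} _ fz (fs fz) (fs fz) (_ , bd , _) = bd refl
no-three-colours {suc (suc zero)} _ (fs fz) fz fz (_ , bd , _) = bd refl
no-three-colours {suc (suc zero)} _ (fs fz) fz (fs fz) (_ , _ , ad) = ad refl

two-colours : ∀ {k} → k ≤ 2 → {a b d : Fin k} → a ≢ d → b ≢ d → a ≡ b
two-colours k≤2 {a} {b} {d} ad bd with a ≟F b
... | yes a≡b = a≡b
... | no a≢b = ⊥-elim (no-three-colours k≤2 a b d (a≢b , bd , ad))

-- Pigeonhole: among five values in at most two colours three coincide.  Either
-- the value at 0 recurs twice, or three of the others avoid it and so agree.
module _ {k} (k≤2 : k ≤ 2) (f : Fin 5 → Fin k) where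
  ThreeEqual : Set
  ThreeEqual = Σ (Fin 5) λ i → Σ (Fin 5) λ j → Σ (Fin 5) λ l → Distinct3 i j l × f i ≡ f j × f j ≡ f l

  private
    recurs : ∀ a b → f (# 0) ≡ f a → f (# 0) ≡ f b → Distinct3 (# 0) a b → ThreeEqual
    recurs a b e₁ e₂ d = # 0 , a , b , d , e₁ , trans (≡-sym e₁) e₂
    avoid : ∀ a b d → f (# 0) ≢ f a → f (# 0) ≢ f b → f (# 0) ≢ f d → Distinct3 a b d → ThreeEqual
    avoid a b d n₁ n₂ n₃ dist = a , b , d , dist , two-colours k≤2 (≢-sym n₁) (≢-sym n₂) , two-colours k≤2 (≢-sym n₂) (≢-sym n₃)

  three-of-five : ThreeEqual
  three-of-five with f (# 0) ≟F f (# 1) | f (# 0) ≟F f (# 2) | f (# 0) ≟F f (# 3) | f (# 0) ≟F f (# 4)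
  ... | yes e₁ | yes e₂ | _ | _ = recurs (# 1) (# 2) e₁ e₂ ((λ ()) , (λ ()) , (λ ()))
  ... | yes e₁ | _ | yes e₃ | _ = recurs (# 1) (# 3) e₁ e₃ ((λ ()) , (λ ()) , (λ ()))
  ... | yes e₁ | _ | _ | yes e₄ = recurs (# 1) (# 4) e₁ e₄ ((λ ()) , (λ ()) , (λ ()))
  ... | _ | yes e₂ | yes e₃ | _ = recurs (# 2) (# 3) e₂ e₃ ((λ ()) , (λ ()) , (λ ()))
  ... | _ | yes e₂ | _ | yes e₄ = recurs (# 2) (# 4) e₂ e₄ ((λ ()) , (λ ()) , (λ ()))
  ... | _ | _ | yes e₃ | yes e₄ = recurs (# 3) (# 4) e₃ e₄ ((λ ()) , (λ ()) , (λ ()))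
  ... | yes _ | no n₂ | no n₃ | no n₄ = avoid (# 2) (# 3) (# 4) n₂ n₃ n₄ ((λ ()) , (λ ()) , (λ ()))
  ... | no n₁ | yes _ | no n₃ | no n₄ = avoid (# 1) (# 3) (# 4) n₁ n₃ n₄ ((λ ()) , (λ ()) , (λ ()))
  ... | no n₁ | no n₂ | yes _ | no n₄ = avoid (# 1) (# 2) (# 4) n₁ n₂ n₄ ((λ ()) , (λ ()) , (λ ()))
  ... | no n₁ | no n₂ | no n₃ | _ = avoid (# 1) (# 2) (# 3) n₁ n₂ n₃ ((λ ()) , (λ ()) , (λ ()))

triple : ∀ {A : Set} → A → A → A → List A
triple x y z = x ∷ y ∷ z ∷ []

no-three-in-two : ∀ {A : Set} {x y z a b : A} → Distinct3 x y z →
  x ∈ a ∷ b ∷ [] → y ∈ a ∷ b ∷ [] → z ∈ a ∷ b ∷ [] → ⊥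
no-three-in-two (xy , _ , _) (here refl) (here refl) _ = xy refl
no-three-in-two (xy , _ , _) (there (here refl)) (there (here refl)) _ = xy refl
no-three-in-two (_ , _ , xz) (here refl) (there (here refl)) (here refl) = xz refl
no-three-in-two (_ , yz , _) (here refl) (there (here refl)) (there (here refl)) = yz refl
no-three-in-two (_ , yz , _) (there (here refl)) (here refl) (here refl) = yz refl
no-three-in-two (_ , _ , xz) (there (here refl)) (here refl) (there (here refl)) = xz refl

rotate∈ : ∀ {A : Set} {v p q r : A} → v ∈ triple p q r → v ∈ triple q r p
rotate∈ (here e) = there (there (here e))
rotate∈ (there (here e)) = here e
rotate∈ (there (there (here e))) = there (here e)

module _ {A : Set} {x y z : A} (dist : Distinct3 x y z) where
  head-covered : ∀ {p q r} → x ∈ triple p q r → y ∈ triple p q r → z ∈ triple p q r → p ∈ triple x y z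
  head-covered (here refl) _ _ = here refl
  head-covered _ (here refl) _ = there (here refl)
  head-covered _ _ (here refl) = there (there (here refl))
  head-covered (there x∈) (there y∈) (there z∈) = ⊥-elim (no-three-in-two dist x∈ y∈ z∈)

  covered : ∀ {p q r} → x ∈ triple p q r → y ∈ triple p q r → z ∈ triple p q r →
    ∀ {v} → v ∈ triple p q r → v ∈ triple x y z
  covered x∈ y∈ z∈ (here refl) = head-covered x∈ y∈ z∈
  covered x∈ y∈ z∈ (there (here refl)) = head-covered (rotate∈ x∈) (rotate∈ y∈) (rotate∈ z∈)
  covered x∈ y∈ z∈ (there (there (here refl))) =
    head-covered (rotate∈ (rotate∈ x∈)) (rotate∈ (rotate∈ y∈)) (rotate∈ (rotate∈ z∈))

module Ramsey {n k} {G : Graph n} (c : Coloring G k) where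
  -- All pairs among x, y, z have colour m (edges of G or not).
  Monochromatic : Fin n → Fin n → Fin n → Fin k → Set
  Monochromatic x y z m = ∀ {p q} → p ∈ triple x y z → q ∈ triple x y z → p ≢ q → col c p q ≡ m

  monochromatic : ∀ {x y z m} → col c x y ≡ m → col c y z ≡ m → col c x z ≡ m → Monochromatic x y z m
  monochromatic xy yz xz (here refl) (here refl) ne = ⊥-elim (ne refl)
  monochromatic xy yz xz (here refl) (there (here refl)) _ = xy
  monochromatic xy yz xz (here refl) (there (there (here refl))) _ = xz
  monochromatic xy yz xz (there (here refl)) (here refl) _ = trans (col-sym c _ _) xy
  monochromatic xy yz xz (there (here refl)) (there (here refl)) ne = ⊥-elim (ne refl)
  monochromatic xy yz xz (there (here refl)) (there (there (here refl))) _ = yz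
  monochromatic xy yz xz (there (there (here refl))) (here refl) _ = trans (col-sym c _ _) xz
  monochromatic xy yz xz (there (there (here refl))) (there (here refl)) _ = trans (col-sym c _ _) yz
  monochromatic xy yz xz (there (there (here refl))) (there (there (here refl))) ne = ⊥-elim (ne refl)

  -- With at most two colours a rainbow tree has at most two edges; one through
  -- three distinct x, y, z is a path on exactly these vertices, so both its
  -- edges lie in the triangle and it cannot be monochromatic.
  no-rainbow-tree : k ≤ 2 → ∀ {W E} → Tree G W E → Unique (colors c E) →
    ∀ {x y z m} → x ∈ W → y ∈ W → z ∈ W → Distinct3 x y z → Monochromatic x y z m → ⊥
  no-rainbow-tree k≤2 (single v) U (here refl) (here refl) _ (xy , _ , _) _ = xy refl
  no-rainbow-tree k≤2 (grow (single w) _ _ _) U x∈ y∈ z∈ dist _ = no-three-in-two dist x∈ y∈ z∈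
  no-rainbow-tree k≤2 {W} (grow (grow (single w) u₁∈ v₁∉ _) u₂∈ v₂∉ _) ((κ₂≢κ₁ All.∷ All.[]) ∷ _)
                  {x} {y} {z} x∈ y∈ z∈ dist mono =
    κ₂≢κ₁ (trans (mono (in-triangle (there u₂∈)) (in-triangle (here refl)) (λ e → v₂∉ (subst (_∈ _) e u₂∈)))
                (≡-sym (mono (in-triangle (there (there u₁∈))) (in-triangle (there (here refl)))
                             (λ e → v₁∉ (subst (_∈ _) e u₁∈)))))
    where
    in-triangle : ∀ {v} → v ∈ W → v ∈ triple x y z
    in-triangle = covered dist x∈ y∈ z∈
  no-rainbow-tree k≤2 (grow (grow (grow _ _ _ _) _ _ _) _ _ _) ((κ₃≢κ₂ All.∷ κ₃≢κ₁ All.∷ _) ∷ ((κ₂≢κ₁ All.∷ _) ∷ _)) _ _ _ _ _ =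
    no-three-colours k≤2 _ _ _ (κ₃≢κ₂ , κ₂≢κ₁ , κ₃≢κ₁)

  Triangle : Set
  Triangle = Σ (Fin n) λ x → Σ (Fin n) λ y → Σ (Fin n) λ z → Σ (Fin k) λ m → Distinct3 x y z × Monochromatic x y z m

  -- If o is joined to distinct a, b, d in colour m, then either an edge among
  -- a, b, d also has colour m, or all three avoid m and so share the other colour.
  from-monochromatic-star : k ≤ 2 → ∀ {o a b d m} → o ≢ a → o ≢ b → o ≢ d → Distinct3 a b d →
    col c o a ≡ m → col c o b ≡ m → col c o d ≡ m → Triangle
  from-monochromatic-star k≤2 {o} {a} {b} {d} {m} oa ob od (ab , bd , ad) κa κb κd
    with col c a b ≟F m | col c b d ≟F m | col c a d ≟F m
  ... | yes κab | _ | _ = o , a , b , m , (oa , ab , ob) , monochromatic κa κab κb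
  ... | no _ | yes κbd | _ = o , b , d , m , (ob , bd , od) , monochromatic κb κbd κd
  ... | no _ | no _ | yes κad = o , a , d , m , (oa , ad , od) , monochromatic κa κad κd
  ... | no κab | no κbd | no κad = a , b , d , col c a b , (ab , bd , ad) ,
                                   monochromatic refl (two-colours k≤2 κbd κab) (two-colours k≤2 κad κab)

  -- R(3,3) ≤ 6: among six distinct vertices one sees three others in the same
  -- colour, which yields a monochromatic triangle.
  monochromatic-triangle : k ≤ 2 → (v : Fin 6 → Fin n) → (∀ {i j} → v i ≡ v j → i ≡ j) → Triangle
  monochromatic-triangle k≤2 v v-inj with three-of-five k≤2 (λ i → col c (v fz) (v (fs i)))
  ... | i , j , l , (ij , jl , il) , e₁ , e₂ =
    from-monochromatic-star k≤2 v₀≢ v₀≢ v₀≢ (≢-image ij , ≢-image jl , ≢-image il) refl (≡-sym e₁) (≡-sym (trans e₁ e₂))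
    where
    v₀≢ : ∀ {p : Fin 5} → v fz ≢ v (fs p)
    v₀≢ e with v-inj e
    ... | ()
    ≢-image : ∀ {p q : Fin 5} → p ≢ q → v (fs p) ≢ v (fs q)
    ≢-image p≢q e with v-inj e
    ... | refl = p≢q refl

-- Graphs with at least six vertices have no 3-rainbow colouring with at most
-- two colours: a monochromatic triangle admits no rainbow tree.
no-two-colour-3rainbow : ∀ {n k} {G : Graph n} → 6 ≤ n → k ≤ 2 → (c : Coloring G k) → Is3Rainbow c → ⊥
no-two-colour-3rainbow 6≤n k≤2 c rainbow
  with Ramsey.monochromatic-triangle c k≤2 (λ i → inject≤ i 6≤n) (λ {i} {j} e → inject≤-injective _ _ i j e)
... | x , y , z , m , (xy , yz , xz) , mono with rainbow x y z xy yz xz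
... | W , E , T , U , x∈ , y∈ , z∈ = Ramsey.no-rainbow-tree c k≤2 T U x∈ y∈ z∈ (xy , yz , xz) mono

rx₃-lower-bound : ∀ {n k} {G : Graph n} → 6 ≤ n → (c : Coloring G k) → Is3Rainbow c → 3 ≤ k
rx₃-lower-bound {k = k} 6≤n c rainbow with 3 ≤?ℕ k
... | yes 3≤k = 3≤k
... | no 3≰k = ⊥-elim (no-two-colour-3rainbow 6≤n (≤-pred (≰⇒> 3≰k)) c rainbow)

-- The case s = t ≥ 3: 3 ≤ rx₃(G ∨ H) ≤ rx₃(K_{s,s}) ≤ 3, the first since
-- G ∨ H has 2s ≥ 6 vertices, the last by the comparison colouring.
balanced : ∀ {s} (G : Graph s) (H : Graph s) → 3 ≤ s →
  ∀ k b → IsRx3 (K s s) k → IsRx3 (G ∨G H) b → (b ≡ k) × (k ≡ 3)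
balanced {s} G H 3≤s k b rxK@((cK , rK) , minimalK) rxB@((cB , rB) , _) =
  ≤-antisym b≤k (≤-trans k≤3 3≤b) , ≤-antisym k≤3 (≤-trans 3≤b b≤k)
  where
  k≤3 : k ≤ 3
  k≤3 = minimalK 3 (BalancedBipartite.c s , BalancedBipartite.rainbow s)
  b≤k : b ≤ k
  b≤k = bound-by-K G H k b rxK rxB
  3≤b : 3 ≤ b
  3≤b = rx₃-lower-bound (+-mono-≤ 3≤s 3≤s) cB rB

theorem8 : ∀ {s t : ℕ} (G : Graph s) (H : Graph t) →
    Connected G → Connected H → (¬ Complete G ⊎ ¬ Complete H) → s ≤ t →
    (s ≡ 1 → ∀ h b → IsRx3 H h → IsRx3 (G ∨G H) b → b ≤ h + 1)
    × (s ≡ 2 → ∀ r k b → IsRc H r → IsRx3 (K s t) k → IsRx3 (G ∨G H) b → b ≤ (r + 3) ⊓ k)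
    × (3 ≤ s → ∀ g h k b → IsRx3 G g → IsRx3 H h → IsRx3 (K s t) k → IsRx3 (G ∨G H) b →
         b ≤ ((g ⊔ h) + 1) ⊓ k)
    × (s ≡ t → 3 ≤ s → ∀ k b → IsRx3 (K s t) k → IsRx3 (G ∨G H) b → (b ≡ k) × (k ≡ 3))
theorem8 G H connectedG connectedH nonComplete s≤t =
  (λ { refl → part1 G H connectedH nonComplete }) ,
  (λ { refl r k b rcH rxK rxB → ⊓-glb (part2 G H connectedG r b rcH rxB) (bound-by-K G H k b rxK rxB) }) ,
  (λ 3≤s g h k b rxG rxH rxK rxB → ⊓-glb (part3 G H 3≤s s≤t g h b rxG rxH rxB) (bound-by-K G H k b rxK rxB)) ,
  (λ { refl 3≤s → balanced G H 3≤s })
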